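{- Let $a$ be an integer. The central transform (defined in the context) of the sequence with generating function $\frac{1+ax}{1-x^2}$ is the INVERT$(a-1)$ transform of the Catalan numbers, i.e. $$\mathbf{C}\!\left(\frac{1+ax}{1-x^2}\right)=\frac{c(x)}{1+(a-1)xc(x)},$$ where $c(x)=\frac{1-\sqrt{1-4x}}{2x}$.
   Context: For a power series $g(x)\in\mathbb{Z}[[x]]$ with $g(0)=1$, let $t_{n,k}=[x^n]\,\frac{1}{1-x}\,\frac{1}{g\left(\frac{x}{1-x}\right)}\left(\frac{x}{1-x}\right)^k$ for $n,k\ge0$, where $[x^n]$ extracts the coefficient of $x^n$. The central transform $\mathbf{C}(g(x))$ is the power series $\sum_{n\ge0}b_nx^n$ with $b_n=t_{2n,n}$. For $\alpha$ a number, the INVERT$(\alpha)$ transform of a sequence with generating function $f(x)$ is the sequence with generating function $\frac{f(x)}{1+\alpha xf(x)}$. The Catalan numbers have generating function $c(x)=\frac{1-\sqrt{1-4x}}{2x}$. -}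

module Defs where

open import Data.Nat as ℕ using (ℕ; zero; suc; _∸_)
open import Data.Nat.Combinatorics using (_C_)
open import Data.Integer using (ℤ; +_; -_; _+_; _*_; _-_; 0ℤ; 1ℤ)
open import Data.Fin using (Fin; toℕ)
open import Data.Vec using (Vec; []; _∷_; head; tabulate; zipWith)
import Data.Vec as Vec

PS : Set
PS = ℕ → ℤ

sumTo : ℕ → (ℕ → ℤ) → ℤ
sumTo zero    f = f zero
sumTo (suc n) f = sumTo n f + f (suc n)

mulPS : PS → PS → PS
mulPS f g n = sumTo n (λ i → f i * g (n ∸ i))

onePS : PS
onePS zero    = 1ℤ
onePS (suc _) = 0ℤ

powPS : PS → ℕ → PS
powPS f zero    = onePS
powPS f (suc k) = mulPS f (powPS f k)

-- Coefficients u_n, u_{n-1}, ..., u_0 of the multiplicative inverse u of f,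
-- valid for series with f 0 = 1 (the only case used):
-- u_0 = 1,  u_{n+1} = - Σ_{i=1}^{n+1} f_i u_{n+1-i}.
invVec : PS → (n : ℕ) → Vec ℤ (suc n)
invVec f zero    = 1ℤ ∷ []
invVec f (suc n) =
  let v = invVec f n in
  (- Vec.foldr _ _+_ 0ℤ (zipWith _*_ (tabulate (λ k → f (suc (toℕ k)))) v)) ∷ v

invPS : PS → PS
invPS f n = head (invVec f n)

xOver1mx : PS
xOver1mx zero    = 0ℤ
xOver1mx (suc _) = 1ℤ

-- g(x/(1-x)) (exact, since x/(1-x) has zero constant term)
composeXOver1mx : PS → PS
composeXOver1mx g n = sumTo n (λ k → g k * powPS xOver1mx k n)

geomPS : PS
geomPS _ = 1ℤ

tTri : PS → ℕ → ℕ → ℤ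
tTri g n k = mulPS geomPS (mulPS (invPS (composeXOver1mx g)) (powPS xOver1mx k)) n

centralTransform : PS → PS
centralTransform g n = tTri g (2 ℕ.* n) n

numer : ℤ → PS
numer a zero          = 1ℤ
numer a (suc zero)    = a
numer a (suc (suc _)) = 0ℤ

oneMinusXSq : PS
oneMinusXSq zero                = 1ℤ
oneMinusXSq (suc zero)          = 0ℤ
oneMinusXSq (suc (suc zero))    = - 1ℤ
oneMinusXSq (suc (suc (suc _))) = 0ℤ

gSeq : ℤ → PS
gSeq a = mulPS (numer a) (invPS oneMinusXSq)

-- Catalan numbers C_n = binom(2n,n)/(n+1), coefficients of c(x) = (1-√(1-4x))/(2x)
catalanPS : PS
catalanPS n = + (((2 ℕ.* n) C n) ℕ./ suc n)

invertTransform : ℤ → PS → PS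
invertTransform α f = mulPS f (invPS den)
  where
  den : PS
  den zero    = 1ℤ
  den (suc n) = α * f n

-- Substituting y = x/(1−x) turns g(y) = (1 + ay)/(1 − y²) into (1 − x)(1 + bx)/(1 − 2x) with
-- b = a − 1, so t_{m,k} = [xᵐ] (1 − 2x) xᵏ / ((1 + bx)(1 − x)^(k+2)) = Σᵢ (−b)ⁱ ballot (m − i) k,
-- where ballot m k = C(m,k) − C(m,k+1).  On the other side c/(1 + bxc) = Σᵢ (−b)ⁱ xⁱ c^(i+1),
-- and [x^j] c^(i+1) = ballot (2j + i) (j + i).  At m = 2n, k = n the two sums agree term by term,
-- the terms i > n on the left vanishing.
module Submission where

open import Defs
open import Algebra.Bundles using (CommutativeMonoid)
open import Data.Fin using (toℕ)
open import Data.Integer using (ℤ; +_; -_; _+_; _*_; _-_; _⊖_; _^_; 0ℤ; 1ℤ)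
import Data.Integer.Properties as ℤₚ
open import Data.Integer.Tactic.RingSolver using (solve-∀)
open import Data.Nat as ℕ using (ℕ; zero; suc; _∸_; _≤_; _<_; z≤n; s≤s)
open import Data.Nat.Combinatorics
  using (_C_; nCk+nC[k+1]≡[n+1]C[k+1]; nCk≡nC[n∸k]; nCn≡1; nC1≡n; k>n⇒nCk≡0)
open import Data.Nat.DivMod using (m*n/n≡m)
import Data.Nat.Properties as ℕₚ
import Data.Nat.Tactic.RingSolver as ℕ-Solver
open import Data.Product using (_,_)
open import Data.Vec using ([]; _∷_; head; tabulate; zipWith)
import Data.Vec as Vec
open import Function using (_∘_)
open import Level using (0ℓ)
open import Relation.Binary.Bundles using (Setoid)
open import Relation.Binary.PropositionalEquality

open ≡-Reasoning

-- Finite sums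

sumTo-cong : ∀ n {f g : ℕ → ℤ} → (∀ i → i ≤ n → f i ≡ g i) → sumTo n f ≡ sumTo n g
sumTo-cong zero    f≡g = f≡g zero z≤n
sumTo-cong (suc n) f≡g =
  cong₂ _+_ (sumTo-cong n (λ i i≤n → f≡g i (ℕₚ.m≤n⇒m≤1+n i≤n))) (f≡g (suc n) ℕₚ.≤-refl)

sumTo-sucˡ : ∀ n (f : ℕ → ℤ) → sumTo (suc n) f ≡ f 0 + sumTo n (f ∘ suc)
sumTo-sucˡ zero    f = refl
sumTo-sucˡ (suc n) f = begin
  sumTo (suc n) f + f (2 ℕ.+ n)             ≡⟨ cong (_+ f (2 ℕ.+ n)) (sumTo-sucˡ n f) ⟩
  (f 0 + sumTo n (f ∘ suc)) + f (2 ℕ.+ n)   ≡⟨ ℤₚ.+-assoc (f 0) _ _ ⟩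
  f 0 + sumTo (suc n) (f ∘ suc)             ∎

sumTo-distrib-+ : ∀ n (f g : ℕ → ℤ) → sumTo n (λ i → f i + g i) ≡ sumTo n f + sumTo n g
sumTo-distrib-+ zero    f g = refl
sumTo-distrib-+ (suc n) f g = begin
  sumTo n (λ i → f i + g i) + (f (suc n) + g (suc n))
    ≡⟨ cong (_+ (f (suc n) + g (suc n))) (sumTo-distrib-+ n f g) ⟩
  (sumTo n f + sumTo n g) + (f (suc n) + g (suc n))
    ≡⟨ +-interchange (sumTo n f) (sumTo n g) (f (suc n)) (g (suc n)) ⟩
  (sumTo n f + f (suc n)) + (sumTo n g + g (suc n)) ∎
  where
  +-interchange : ∀ w x y z → (w + x) + (y + z) ≡ (w + y) + (x + z)
  +-interchange = solve-∀

sumTo-*ˡ : ∀ n (c : ℤ) (f : ℕ → ℤ) → sumTo n (λ i → c * f i) ≡ c * sumTo n f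
sumTo-*ˡ zero    c f = refl
sumTo-*ˡ (suc n) c f = trans (cong (_+ c * f (suc n)) (sumTo-*ˡ n c f))
                             (sym (ℤₚ.*-distribˡ-+ c (sumTo n f) (f (suc n))))

sumTo-*ʳ : ∀ n (c : ℤ) (f : ℕ → ℤ) → sumTo n (λ i → f i * c) ≡ sumTo n f * c
sumTo-*ʳ zero    c f = refl
sumTo-*ʳ (suc n) c f = trans (cong (_+ f (suc n) * c) (sumTo-*ʳ n c f))
                             (sym (ℤₚ.*-distribʳ-+ c (sumTo n f) (f (suc n))))

sumTo-zeroˡ : ∀ n (f : ℕ → ℤ) → sumTo n (λ i → 0ℤ * f i) ≡ 0ℤ
sumTo-zeroˡ n f = trans (sumTo-*ˡ n 0ℤ f) (ℤₚ.*-zeroˡ (sumTo n f))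

sumTo-reverse : ∀ n (f : ℕ → ℤ) → sumTo n f ≡ sumTo n (λ i → f (n ∸ i))
sumTo-reverse zero    f = refl
sumTo-reverse (suc n) f = begin
  sumTo n f + f (suc n)                    ≡⟨ cong (_+ f (suc n)) (sumTo-reverse n f) ⟩
  sumTo n (λ i → f (n ∸ i)) + f (suc n)    ≡⟨ ℤₚ.+-comm _ (f (suc n)) ⟩
  f (suc n) + sumTo n (λ i → f (n ∸ i))    ≡⟨ sumTo-sucˡ n (λ i → f (suc n ∸ i)) ⟨
  sumTo (suc n) (λ i → f (suc n ∸ i))      ∎

sumTo-extendʳ : ∀ n k (f : ℕ → ℤ) → (∀ i → n < i → i ≤ k ℕ.+ n → f i ≡ 0ℤ) →
                sumTo (k ℕ.+ n) f ≡ sumTo n f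
sumTo-extendʳ n zero    f f≡0 = refl
sumTo-extendʳ n (suc k) f f≡0 = begin
  sumTo (k ℕ.+ n) f + f (suc k ℕ.+ n)
    ≡⟨ cong₂ _+_ (sumTo-extendʳ n k f (λ i n<i i≤k+n → f≡0 i n<i (ℕₚ.m≤n⇒m≤1+n i≤k+n)))
                 (f≡0 (suc k ℕ.+ n) (s≤s (ℕₚ.m≤n+m n k)) ℕₚ.≤-refl) ⟩
  sumTo n f + 0ℤ
    ≡⟨ ℤₚ.+-identityʳ _ ⟩
  sumTo n f ∎

sumTo-triangle : ∀ n (F : ℕ → ℕ → ℤ) →
  sumTo n (λ k → sumTo (n ∸ k) (F k)) ≡ sumTo n (λ s → sumTo s (λ k → F k (s ∸ k)))
sumTo-triangle zero    F = refl
sumTo-triangle (suc n) F = begin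
  sumTo n (λ k → sumTo (suc n ∸ k) (F k)) + sumTo (n ∸ n) (F (suc n))
    ≡⟨ cong₂ _+_ (sumTo-cong n (λ k k≤n → cong (λ m → sumTo m (F k)) (ℕₚ.+-∸-assoc 1 k≤n)))
                 (cong (λ m → sumTo m (F (suc n))) (ℕₚ.n∸n≡0 n)) ⟩
  sumTo n (λ k → sumTo (n ∸ k) (F k) + F k (suc (n ∸ k))) + F (suc n) 0
    ≡⟨ cong (_+ F (suc n) 0) (sumTo-distrib-+ n _ _) ⟩
  (sumTo n (λ k → sumTo (n ∸ k) (F k)) + sumTo n (λ k → F k (suc (n ∸ k)))) + F (suc n) 0
    ≡⟨ ℤₚ.+-assoc (sumTo n (λ k → sumTo (n ∸ k) (F k))) _ _ ⟩
  sumTo n (λ k → sumTo (n ∸ k) (F k)) + (sumTo n (λ k → F k (suc (n ∸ k))) + F (suc n) 0)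
    ≡⟨ cong₂ _+_ (sumTo-triangle n F)
                 (cong₂ _+_ (sumTo-cong n (λ k k≤n → cong (F k) (sym (ℕₚ.+-∸-assoc 1 k≤n))))
                            (cong (F (suc n)) (sym (ℕₚ.n∸n≡0 (suc n))))) ⟩
  sumTo n (λ s → sumTo s (λ k → F k (s ∸ k))) + sumTo (suc n) (λ k → F k (suc n ∸ k)) ∎

sumTo-swap : ∀ n (F : ℕ → ℕ → ℤ) →
  sumTo n (λ k → sumTo (n ∸ k) (F k)) ≡ sumTo n (λ i → sumTo (n ∸ i) (λ k → F k i))
sumTo-swap n F = begin
  sumTo n (λ k → sumTo (n ∸ k) (F k))
    ≡⟨ sumTo-triangle n F ⟩
  sumTo n (λ s → sumTo s (λ k → F k (s ∸ k)))
    ≡⟨ sumTo-cong n (λ s _ → sumTo-reverse s _) ⟩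
  sumTo n (λ s → sumTo s (λ i → F (s ∸ i) (s ∸ (s ∸ i))))
    ≡⟨ sumTo-cong n (λ s _ → sumTo-cong s (λ i i≤s → cong (F (s ∸ i)) (ℕₚ.m∸[m∸n]≡n i≤s))) ⟩
  sumTo n (λ s → sumTo s (λ i → F (s ∸ i) i))
    ≡⟨ sumTo-triangle n (λ i k → F k i) ⟨
  sumTo n (λ i → sumTo (n ∸ i) (λ k → F k i)) ∎

-- Power series under the Cauchy product

mulPS-cong : ∀ {f f′ g g′} → f ≗ f′ → g ≗ g′ → mulPS f g ≗ mulPS f′ g′
mulPS-cong f≗f′ g≗g′ n = sumTo-cong n (λ i _ → cong₂ _*_ (f≗f′ i) (g≗g′ (n ∸ i)))

mulPS-congˡ : ∀ f {g g′} → g ≗ g′ → mulPS f g ≗ mulPS f g′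
mulPS-congˡ f = mulPS-cong {f} (λ _ → refl)

mulPS-congʳ : ∀ {f f′} g → f ≗ f′ → mulPS f g ≗ mulPS f′ g
mulPS-congʳ g f≗f′ = mulPS-cong {g = g} f≗f′ (λ _ → refl)

mulPS-comm : ∀ f g → mulPS f g ≗ mulPS g f
mulPS-comm f g n = begin
  sumTo n (λ i → f i * g (n ∸ i))
    ≡⟨ sumTo-reverse n _ ⟩
  sumTo n (λ i → f (n ∸ i) * g (n ∸ (n ∸ i)))
    ≡⟨ sumTo-cong n (λ i i≤n → trans (cong (λ j → f (n ∸ i) * g j) (ℕₚ.m∸[m∸n]≡n i≤n))
                                     (ℤₚ.*-comm (f (n ∸ i)) (g i))) ⟩
  sumTo n (λ i → g i * f (n ∸ i)) ∎

mulPS-assoc : ∀ f g h → mulPS (mulPS f g) h ≗ mulPS f (mulPS g h)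
mulPS-assoc f g h n = begin
  sumTo n (λ s → sumTo s (λ i → f i * g (s ∸ i)) * h (n ∸ s))
    ≡⟨ sumTo-cong n (λ s _ → sym (sumTo-*ʳ s (h (n ∸ s)) _)) ⟩
  sumTo n (λ s → sumTo s (λ i → f i * g (s ∸ i) * h (n ∸ s)))
    ≡⟨ sumTo-cong n (λ s _ → sumTo-cong s (λ i i≤s →
         trans (ℤₚ.*-assoc (f i) _ _) (cong (λ j → f i * (g (s ∸ i) * h j)) (sym (∸-∸-cancel i≤s))))) ⟩
  sumTo n (λ s → sumTo s (λ i → f i * (g (s ∸ i) * h ((n ∸ i) ∸ (s ∸ i)))))
    ≡⟨ sumTo-triangle n (λ i j → f i * (g j * h ((n ∸ i) ∸ j))) ⟨
  sumTo n (λ i → sumTo (n ∸ i) (λ j → f i * (g j * h ((n ∸ i) ∸ j))))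
    ≡⟨ sumTo-cong n (λ i _ → sumTo-*ˡ (n ∸ i) (f i) _) ⟩
  sumTo n (λ i → f i * sumTo (n ∸ i) (λ j → g j * h ((n ∸ i) ∸ j))) ∎
  where
  ∸-∸-cancel : ∀ {i s} → i ≤ s → (n ∸ i) ∸ (s ∸ i) ≡ n ∸ s
  ∸-∸-cancel {i} {s} i≤s = trans (ℕₚ.∸-+-assoc n i (s ∸ i)) (cong (n ∸_) (ℕₚ.m+[n∸m]≡n i≤s))

mulPS-identityˡ : ∀ f → mulPS onePS f ≗ f
mulPS-identityˡ f zero    = ℤₚ.*-identityˡ (f 0)
mulPS-identityˡ f (suc n) = begin
  sumTo (suc n) (λ i → onePS i * f (suc n ∸ i))
    ≡⟨ sumTo-sucˡ n _ ⟩
  1ℤ * f (suc n) + sumTo n (λ i → 0ℤ * f (n ∸ i))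
    ≡⟨ cong₂ _+_ (ℤₚ.*-identityˡ (f (suc n))) (sumTo-zeroˡ n (λ i → f (n ∸ i))) ⟩
  f (suc n) + 0ℤ
    ≡⟨ ℤₚ.+-identityʳ _ ⟩
  f (suc n) ∎

mulPS-commutativeMonoid : CommutativeMonoid 0ℓ 0ℓ
mulPS-commutativeMonoid = record
  { Carrier             = PS
  ; _≈_                 = _≗_
  ; _∙_                 = mulPS
  ; ε                   = onePS
  ; isCommutativeMonoid = record
    { isMonoid = record
      { isSemigroup = record
        { isMagma = record
          { isEquivalence = Setoid.isEquivalence (ℕ →-setoid ℤ)
          ; ∙-cong        = mulPS-cong
          }
        ; assoc = mulPS-assoc
        }
      ; identity = mulPS-identityˡ , λ f n → trans (mulPS-comm f onePS n) (mulPS-identityˡ f n)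
      }
    ; comm = mulPS-comm
    }
  }

foldr-+-zipWith-*-tabulate : ∀ n (φ ψ : ℕ → ℤ) →
  Vec.foldr _ _+_ 0ℤ (zipWith _*_ (tabulate {n = suc n} (φ ∘ toℕ)) (tabulate (ψ ∘ toℕ)))
  ≡ sumTo n (λ k → φ k * ψ k)
foldr-+-zipWith-*-tabulate zero    φ ψ = ℤₚ.+-identityʳ (φ 0 * ψ 0)
foldr-+-zipWith-*-tabulate (suc n) φ ψ =
  trans (cong (λ s → φ 0 * ψ 0 + s) (foldr-+-zipWith-*-tabulate n (φ ∘ suc) (ψ ∘ suc)))
        (sym (sumTo-sucˡ n (λ k → φ k * ψ k)))

invVec-tabulate : ∀ (f h : PS) → h 0 ≡ 1ℤ →
  (∀ n → h (suc n) ≡ - sumTo n (λ k → f (suc k) * h (n ∸ k))) →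
  ∀ n → invVec f n ≡ tabulate (λ j → h (n ∸ toℕ j))
invVec-tabulate f h h₀≡1 h-rec zero    = cong (_∷ []) (sym h₀≡1)
invVec-tabulate f h h₀≡1 h-rec (suc n) rewrite invVec-tabulate f h h₀≡1 h-rec n =
  cong (_∷ tabulate (λ j → h (n ∸ toℕ j)))
       (trans (cong -_ (foldr-+-zipWith-*-tabulate n (f ∘ suc) (λ k → h (n ∸ k)))) (sym (h-rec n)))

invPS-unique : ∀ f h → f 0 ≡ 1ℤ → mulPS f h ≗ onePS → invPS f ≗ h
invPS-unique f h f₀≡1 fh≗1 n = cong head (invVec-tabulate f h h₀≡1 h-rec n)
  where
  h₀≡1 : h 0 ≡ 1ℤ
  h₀≡1 = trans (sym (ℤₚ.*-identityˡ (h 0))) (trans (cong (_* h 0) (sym f₀≡1)) (fh≗1 0))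
  h-rec : ∀ n → h (suc n) ≡ - sumTo n (λ k → f (suc k) * h (n ∸ k))
  h-rec n = begin
    h (suc n)                          ≡⟨ rearrange (h (suc n)) s ⟩
    (1ℤ * h (suc n) + s) - s           ≡⟨ cong (λ c → (c * h (suc n) + s) - s) f₀≡1 ⟨
    (f 0 * h (suc n) + s) - s          ≡⟨ cong (_- s) (trans (sym (sumTo-sucˡ n _)) (fh≗1 (suc n))) ⟩
    0ℤ - s                             ≡⟨ ℤₚ.+-identityˡ (- s) ⟩
    - s                                ∎
    where
    s = sumTo n (λ k → f (suc k) * h (n ∸ k))
    rearrange : ∀ x s → x ≡ (1ℤ * x + s) - s
    rearrange = solve-∀

linearPS : ℤ → ℤ → PS
linearPS p₀ p₁ zero          = p₀
linearPS p₀ p₁ (suc zero)    = p₁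
linearPS p₀ p₁ (suc (suc _)) = 0ℤ

mulPS-linearPS-suc : ∀ p₀ p₁ f m → mulPS (linearPS p₀ p₁) f (suc m) ≡ p₀ * f (suc m) + p₁ * f m
mulPS-linearPS-suc p₀ p₁ f zero    = refl
mulPS-linearPS-suc p₀ p₁ f (suc m) = begin
  mulPS (linearPS p₀ p₁) f (2 ℕ.+ m)
    ≡⟨ sumTo-sucˡ (suc m) _ ⟩
  p₀ * f (2 ℕ.+ m) + sumTo (suc m) (λ i → linearPS p₀ p₁ (suc i) * f (suc m ∸ i))
    ≡⟨ cong (λ s → p₀ * f (2 ℕ.+ m) + s) (sumTo-sucˡ m _) ⟩
  p₀ * f (2 ℕ.+ m) + (p₁ * f (suc m) + sumTo m (λ i → 0ℤ * f (m ∸ i)))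
    ≡⟨ cong (λ s → p₀ * f (2 ℕ.+ m) + (p₁ * f (suc m) + s)) (sumTo-zeroˡ m (λ i → f (m ∸ i))) ⟩
  p₀ * f (2 ℕ.+ m) + (p₁ * f (suc m) + 0ℤ)
    ≡⟨ cong (λ s → p₀ * f (2 ℕ.+ m) + s) (ℤₚ.+-identityʳ (p₁ * f (suc m))) ⟩
  p₀ * f (2 ℕ.+ m) + p₁ * f (suc m) ∎

[1-x] : PS
[1-x] = linearPS 1ℤ (- 1ℤ)

[1-2x] : PS
[1-2x] = linearPS 1ℤ (- + 2)

geometricPS : ℤ → PS
geometricPS c i = c ^ i

mulPS-linearPS-geometricPS : ∀ c → mulPS (linearPS 1ℤ c) (geometricPS (- c)) ≗ onePS
mulPS-linearPS-geometricPS c zero    = refl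
mulPS-linearPS-geometricPS c (suc m) =
  trans (mulPS-linearPS-suc 1ℤ c (geometricPS (- c)) m) (cancel c ((- c) ^ m))
  where
  cancel : ∀ c x → 1ℤ * (- c * x) + c * x ≡ 0ℤ
  cancel = solve-∀

[1-x]*geomPS≗1 : mulPS [1-x] geomPS ≗ onePS
[1-x]*geomPS≗1 zero    = refl
[1-x]*geomPS≗1 (suc m) = mulPS-linearPS-suc 1ℤ (- 1ℤ) geomPS m

mulPS-geomPS : ∀ f m → mulPS geomPS f m ≡ sumTo m f
mulPS-geomPS f m = trans (sumTo-cong m (λ i _ → ℤₚ.*-identityˡ (f (m ∸ i)))) (sym (sumTo-reverse m f))

mulPS-xOver1mx-suc : ∀ f m → mulPS xOver1mx f (suc m) ≡ sumTo m f
mulPS-xOver1mx-suc f m = begin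
  mulPS xOver1mx f (suc m)                           ≡⟨ sumTo-sucˡ m _ ⟩
  0ℤ * f (suc m) + mulPS geomPS f m                  ≡⟨ cong (_+ mulPS geomPS f m) (ℤₚ.*-zeroˡ (f (suc m))) ⟩
  0ℤ + mulPS geomPS f m                              ≡⟨ ℤₚ.+-identityˡ _ ⟩
  mulPS geomPS f m                                   ≡⟨ mulPS-geomPS f m ⟩
  sumTo m f                                          ∎

-- Binomial coefficients and ballot numbers

sumTo-tCk≡[1+m]C[1+k] : ∀ m k → sumTo m (λ t → + (t C k)) ≡ + (suc m C suc k)
sumTo-tCk≡[1+m]C[1+k] zero    k = cong +_ (trans (sym (ℕₚ.+-identityʳ (0 C k))) (nCk+nC[k+1]≡[n+1]C[k+1] 0 k))
sumTo-tCk≡[1+m]C[1+k] (suc m) k = begin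
  sumTo m (λ t → + (t C k)) + + (suc m C k)   ≡⟨ cong (_+ + (suc m C k)) (sumTo-tCk≡[1+m]C[1+k] m k) ⟩
  + (suc m C suc k) + + (suc m C k)           ≡⟨ ℤₚ.+-comm (+ (suc m C suc k)) (+ (suc m C k)) ⟩
  + (suc m C k) + + (suc m C suc k)           ≡⟨ cong +_ (nCk+nC[k+1]≡[n+1]C[k+1] (suc m) k) ⟩
  + (suc (suc m) C suc k)                     ∎

[1+k]*[1+m]C[1+k]≡[1+m]*mCk : ∀ m k → suc k ℕ.* (suc m C suc k) ≡ suc m ℕ.* (m C k)
[1+k]*[1+m]C[1+k]≡[1+m]*mCk zero    zero    = refl
[1+k]*[1+m]C[1+k]≡[1+m]*mCk zero    (suc k) = ℕₚ.*-zeroʳ (2 ℕ.+ k)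
[1+k]*[1+m]C[1+k]≡[1+m]*mCk (suc m) zero    =
  trans (ℕₚ.*-identityˡ _) (trans (nC1≡n (suc (suc m))) (sym (ℕₚ.*-identityʳ _)))
[1+k]*[1+m]C[1+k]≡[1+m]*mCk (suc m) (suc k) = begin
  (2 ℕ.+ k) ℕ.* (suc (suc m) C suc (suc k))
    ≡⟨ cong ((2 ℕ.+ k) ℕ.*_) (sym (nCk+nC[k+1]≡[n+1]C[k+1] (suc m) (suc k))) ⟩
  (2 ℕ.+ k) ℕ.* (A ℕ.+ B)
    ≡⟨ expand k A B ⟩
  suc k ℕ.* A ℕ.+ A ℕ.+ (2 ℕ.+ k) ℕ.* B
    ≡⟨ cong₂ (λ u v → u ℕ.+ A ℕ.+ v) ([1+k]*[1+m]C[1+k]≡[1+m]*mCk m k)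
                                      ([1+k]*[1+m]C[1+k]≡[1+m]*mCk m (suc k)) ⟩
  suc m ℕ.* p ℕ.+ A ℕ.+ suc m ℕ.* q
    ≡⟨ cong (λ u → suc m ℕ.* p ℕ.+ u ℕ.+ suc m ℕ.* q) (sym (nCk+nC[k+1]≡[n+1]C[k+1] m k)) ⟩
  suc m ℕ.* p ℕ.+ (p ℕ.+ q) ℕ.+ suc m ℕ.* q
    ≡⟨ collect m p q ⟩
  (2 ℕ.+ m) ℕ.* (p ℕ.+ q)
    ≡⟨ cong ((2 ℕ.+ m) ℕ.*_) (nCk+nC[k+1]≡[n+1]C[k+1] m k) ⟩
  (2 ℕ.+ m) ℕ.* (suc m C suc k) ∎
  where
  p = m C k
  q = m C suc k
  A = suc m C suc k
  B = suc m C suc (suc k)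
  expand : ∀ k A B → (2 ℕ.+ k) ℕ.* (A ℕ.+ B) ≡ suc k ℕ.* A ℕ.+ A ℕ.+ (2 ℕ.+ k) ℕ.* B
  expand = ℕ-Solver.solve-∀
  collect : ∀ m p q → suc m ℕ.* p ℕ.+ (p ℕ.+ q) ℕ.+ suc m ℕ.* q ≡ (2 ℕ.+ m) ℕ.* (p ℕ.+ q)
  collect = ℕ-Solver.solve-∀

[1+k]*mC[1+k]+k*mCk≡m*mCk : ∀ m k → suc k ℕ.* (m C suc k) ℕ.+ k ℕ.* (m C k) ≡ m ℕ.* (m C k)
[1+k]*mC[1+k]+k*mCk≡m*mCk m k = ℕₚ.+-cancelʳ-≡ p _ _ (begin
  suc k ℕ.* q ℕ.+ k ℕ.* p ℕ.+ p   ≡⟨ collect k p q ⟩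
  suc k ℕ.* (p ℕ.+ q)             ≡⟨ cong (suc k ℕ.*_) (nCk+nC[k+1]≡[n+1]C[k+1] m k) ⟩
  suc k ℕ.* (suc m C suc k)       ≡⟨ [1+k]*[1+m]C[1+k]≡[1+m]*mCk m k ⟩
  suc m ℕ.* p                     ≡⟨ ℕₚ.+-comm p (m ℕ.* p) ⟩
  m ℕ.* p ℕ.+ p                   ∎)
  where
  p = m C k
  q = m C suc k
  collect : ∀ k p q → suc k ℕ.* q ℕ.+ k ℕ.* p ℕ.+ p ≡ suc k ℕ.* (p ℕ.+ q)
  collect = ℕ-Solver.solve-∀

ballot : ℕ → ℕ → ℤ
ballot m k = + (m C k) - + (m C suc k)

ballot-pascal : ∀ m k → ballot (suc m) (suc k) ≡ ballot m k + ballot m (suc k)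
ballot-pascal m k = begin
  + (suc m C suc k) - + (suc m C suc (suc k))
    ≡⟨ cong₂ (λ u v → + u - + v) (sym (nCk+nC[k+1]≡[n+1]C[k+1] m k))
                                  (sym (nCk+nC[k+1]≡[n+1]C[k+1] m (suc k))) ⟩
  + (p ℕ.+ q) - + (q ℕ.+ r)
    ≡⟨ cong₂ _-_ (ℤₚ.pos-+ p q) (ℤₚ.pos-+ q r) ⟩
  (+ p + + q) - (+ q + + r)
    ≡⟨ telescope (+ p) (+ q) (+ r) ⟩
  (+ p - + q) + (+ q - + r) ∎
  where
  p = m C k
  q = m C suc k
  r = m C suc (suc k)
  telescope : ∀ p q r → (p + q) - (q + r) ≡ (p - q) + (q - r)
  telescope = solve-∀

ballot-diagonal : ∀ k → ballot k k ≡ 1ℤ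
ballot-diagonal k = cong₂ (λ u v → + u - + v) (nCn≡1 k) (k>n⇒nCk≡0 (ℕₚ.n<1+n k))

ballot-< : ∀ {m k} → m < k → ballot m k ≡ 0ℤ
ballot-< m<k = cong₂ (λ u v → + u - + v) (k>n⇒nCk≡0 m<k) (k>n⇒nCk≡0 (ℕₚ.m<n⇒m<1+n m<k))

ballot-middle : ∀ m → ballot (suc (m ℕ.+ m)) m ≡ 0ℤ
ballot-middle m = begin
  + (N C m) - + (N C suc m)      ≡⟨ cong (λ u → + u - + (N C suc m)) (nCk≡nC[n∸k] m≤N) ⟩
  + (N C (N ∸ m)) - + (N C suc m) ≡⟨ cong (λ j → + (N C j) - + (N C suc m)) N∸m≡1+m ⟩
  + (N C suc m) - + (N C suc m)  ≡⟨ ℤₚ.+-inverseʳ (+ (N C suc m)) ⟩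
  0ℤ                             ∎
  where
  N = suc (m ℕ.+ m)
  m≤N : m ≤ N
  m≤N = ℕₚ.m≤n⇒m≤1+n (ℕₚ.m≤m+n m m)
  N∸m≡1+m : N ∸ m ≡ suc m
  N∸m≡1+m = trans (cong (_∸ m) (sym (ℕₚ.+-suc m m))) (ℕₚ.m+n∸m≡n m (suc m))

catalanPS≡ballot : ∀ n → catalanPS n ≡ ballot (n ℕ.+ n) n
catalanPS≡ballot n = begin
  + ((2 ℕ.* n C n) ℕ./ suc n)  ≡⟨ cong (λ m → + ((m C n) ℕ./ suc n)) (cong (n ℕ.+_) (ℕₚ.+-identityʳ n)) ⟩
  + (X ℕ./ suc n)              ≡⟨ cong (λ x → + (x ℕ./ suc n)) X≡[X∸Y]*[1+n] ⟩
  + ((X ∸ Y) ℕ.* suc n ℕ./ suc n) ≡⟨ cong +_ (m*n/n≡m (X ∸ Y) (suc n)) ⟩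
  + (X ∸ Y)                    ≡⟨ sym (ℤₚ.⊖-≥ Y≤X) ⟩
  X ⊖ Y                        ≡⟨ sym (ℤₚ.m-n≡m⊖n X Y) ⟩
  + X - + Y                    ∎
  where
  X = (n ℕ.+ n) C n
  Y = (n ℕ.+ n) C suc n
  [1+n]*Y≡n*X : suc n ℕ.* Y ≡ n ℕ.* X
  [1+n]*Y≡n*X = ℕₚ.+-cancelʳ-≡ (n ℕ.* X) _ _
    (trans ([1+k]*mC[1+k]+k*mCk≡m*mCk (n ℕ.+ n) n) (ℕₚ.*-distribʳ-+ X n n))
  Y≤X : Y ≤ X
  Y≤X = ℕₚ.*-cancelˡ-≤ (suc n) (subst (ℕ._≤ suc n ℕ.* X) (sym [1+n]*Y≡n*X) (ℕₚ.m≤n+m (n ℕ.* X) X))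
  X≡[X∸Y]*[1+n] : X ≡ (X ∸ Y) ℕ.* suc n
  X≡[X∸Y]*[1+n] = trans (ℕₚ.+-cancelʳ-≡ (n ℕ.* X) _ _ (begin
    X ℕ.+ n ℕ.* X                   ≡⟨ cong (suc n ℕ.*_) (ℕₚ.m∸n+n≡m Y≤X) ⟨
    suc n ℕ.* ((X ∸ Y) ℕ.+ Y)       ≡⟨ ℕₚ.*-distribˡ-+ (suc n) (X ∸ Y) Y ⟩
    suc n ℕ.* (X ∸ Y) ℕ.+ suc n ℕ.* Y ≡⟨ cong (suc n ℕ.* (X ∸ Y) ℕ.+_) [1+n]*Y≡n*X ⟩
    suc n ℕ.* (X ∸ Y) ℕ.+ n ℕ.* X   ∎)) (ℕₚ.*-comm (suc n) (X ∸ Y))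

1*[1+m]C[1+k]-2*mC[1+k]≡ballot : ∀ m k → 1ℤ * + (suc m C suc k) + - + 2 * + (m C suc k) ≡ ballot m k
1*[1+m]C[1+k]-2*mC[1+k]≡ballot m k = begin
  1ℤ * + (suc m C suc k) + - + 2 * + (m C suc k)
    ≡⟨ cong (λ c → 1ℤ * + c + - + 2 * + (m C suc k))
            (sym (nCk+nC[k+1]≡[n+1]C[k+1] m k)) ⟩
  1ℤ * + (m C k ℕ.+ m C suc k) + - + 2 * + (m C suc k)
    ≡⟨ cong (λ c → 1ℤ * c + - + 2 * + (m C suc k)) (ℤₚ.pos-+ (m C k) (m C suc k)) ⟩
  1ℤ * (+ (m C k) + + (m C suc k)) + - + 2 * + (m C suc k)
    ≡⟨ simplify (+ (m C k)) (+ (m C suc k)) ⟩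
  ballot m k ∎
  where
  simplify : ∀ p q → 1ℤ * (p + q) + - + 2 * q ≡ p - q
  simplify = solve-∀

-- Powers of the Catalan series

-- catalanPowPS k m = [xᵐ] c(x)ᵏ; the recurrence is c^(k+1) = c^k + x c^(k+2), i.e. c = 1 + x c².
catalanPowPS : ℕ → PS
catalanPowPS k       zero    = 1ℤ
catalanPowPS zero    (suc m) = 0ℤ
catalanPowPS (suc k) (suc m) = catalanPowPS k (suc m) + catalanPowPS (suc (suc k)) m

mulPS-catalanPowPS : ∀ k l → mulPS (catalanPowPS k) (catalanPowPS l) ≗ catalanPowPS (k ℕ.+ l)
mulPS-catalanPowPS k       l zero    = refl
mulPS-catalanPowPS zero    l (suc m) = begin
  mulPS (catalanPowPS 0) (catalanPowPS l) (suc m)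
    ≡⟨ sumTo-sucˡ m _ ⟩
  1ℤ * catalanPowPS l (suc m) + sumTo m (λ i → 0ℤ * catalanPowPS l (m ∸ i))
    ≡⟨ cong₂ _+_ (ℤₚ.*-identityˡ (catalanPowPS l (suc m))) (sumTo-zeroˡ m (λ i → catalanPowPS l (m ∸ i))) ⟩
  catalanPowPS l (suc m) + 0ℤ
    ≡⟨ ℤₚ.+-identityʳ _ ⟩
  catalanPowPS l (suc m) ∎
mulPS-catalanPowPS (suc k) l (suc m) = begin
  mulPS (catalanPowPS (suc k)) Cˡ (suc m)
    ≡⟨ sumTo-sucˡ m _ ⟩
  1ℤ * Cˡ (suc m) + sumTo m (λ i → (catalanPowPS k (suc i) + catalanPowPS (2 ℕ.+ k) i) * Cˡ (m ∸ i))
    ≡⟨ cong (λ s → 1ℤ * Cˡ (suc m) + s)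
            (trans (sumTo-cong m (λ i _ → ℤₚ.*-distribʳ-+ (Cˡ (m ∸ i)) (catalanPowPS k (suc i)) _))
                   (sumTo-distrib-+ m _ _)) ⟩
  1ℤ * Cˡ (suc m) + (sumTo m (λ i → catalanPowPS k (suc i) * Cˡ (m ∸ i))
                     + mulPS (catalanPowPS (2 ℕ.+ k)) Cˡ m)
    ≡⟨ ℤₚ.+-assoc (1ℤ * Cˡ (suc m)) _ _ ⟨
  (1ℤ * Cˡ (suc m) + sumTo m (λ i → catalanPowPS k (suc i) * Cˡ (m ∸ i)))
                   + mulPS (catalanPowPS (2 ℕ.+ k)) Cˡ m
    ≡⟨ cong (_+ mulPS (catalanPowPS (2 ℕ.+ k)) Cˡ m) (sumTo-sucˡ m _) ⟨
  mulPS (catalanPowPS k) Cˡ (suc m) + mulPS (catalanPowPS (2 ℕ.+ k)) Cˡ m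
    ≡⟨ cong₂ _+_ (mulPS-catalanPowPS k l (suc m)) (mulPS-catalanPowPS (2 ℕ.+ k) l m) ⟩
  catalanPowPS (suc k ℕ.+ l) (suc m) ∎
  where
  Cˡ = catalanPowPS l

catalanPowPS-ballot : ∀ k m → catalanPowPS (suc k) m ≡ ballot (m ℕ.+ m ℕ.+ k) (m ℕ.+ k)
catalanPowPS-ballot k       zero    = sym (ballot-diagonal k)
catalanPowPS-ballot zero    (suc m) = begin
  0ℤ + catalanPowPS 2 m
    ≡⟨ ℤₚ.+-identityˡ _ ⟩
  catalanPowPS 2 m
    ≡⟨ catalanPowPS-ballot 1 m ⟩
  ballot N (m ℕ.+ 1)
    ≡⟨ cong (ballot N) (ℕₚ.+-comm m 1) ⟩
  ballot N (suc m)
    ≡⟨ ℤₚ.+-identityˡ _ ⟨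
  0ℤ + ballot N (suc m)
    ≡⟨ cong (_+ ballot N (suc m)) (trans (cong (λ j → ballot j m) N≡1+2m) (ballot-middle m)) ⟨
  ballot N m + ballot N (suc m)
    ≡⟨ ballot-pascal N m ⟨
  ballot (suc N) (suc m)
    ≡⟨ cong₂ ballot (index₁ m) (sym (ℕₚ.+-identityʳ (suc m))) ⟩
  ballot (suc m ℕ.+ suc m ℕ.+ 0) (suc m ℕ.+ 0) ∎
  where
  N = m ℕ.+ m ℕ.+ 1
  N≡1+2m : N ≡ suc (m ℕ.+ m)
  N≡1+2m = ℕₚ.+-comm (m ℕ.+ m) 1
  index₁ : ∀ m → suc (m ℕ.+ m ℕ.+ 1) ≡ suc m ℕ.+ suc m ℕ.+ 0
  index₁ = ℕ-Solver.solve-∀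
catalanPowPS-ballot (suc k) (suc m) = begin
  catalanPowPS (suc k) (suc m) + catalanPowPS (3 ℕ.+ k) m
    ≡⟨ cong₂ _+_ (catalanPowPS-ballot k (suc m)) (catalanPowPS-ballot (2 ℕ.+ k) m) ⟩
  ballot N K + ballot (m ℕ.+ m ℕ.+ (2 ℕ.+ k)) (m ℕ.+ (2 ℕ.+ k))
    ≡⟨ cong₂ (λ i j → ballot N K + ballot i j) (index₁ m k) (index₂ m k) ⟩
  ballot N K + ballot N (suc K)
    ≡⟨ ballot-pascal N K ⟨
  ballot (suc N) (suc K)
    ≡⟨ cong₂ ballot (index₃ m k) (ℕₚ.+-suc (suc m) k) ⟨
  ballot (suc m ℕ.+ suc m ℕ.+ suc k) (suc m ℕ.+ suc k) ∎
  where
  N = suc m ℕ.+ suc m ℕ.+ k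
  K = suc m ℕ.+ k
  index₁ : ∀ m k → m ℕ.+ m ℕ.+ (2 ℕ.+ k) ≡ suc m ℕ.+ suc m ℕ.+ k
  index₁ = ℕ-Solver.solve-∀
  index₂ : ∀ m k → m ℕ.+ (2 ℕ.+ k) ≡ suc (suc m ℕ.+ k)
  index₂ = ℕ-Solver.solve-∀
  index₃ : ∀ m k → suc m ℕ.+ suc m ℕ.+ suc k ≡ suc (suc m ℕ.+ suc m ℕ.+ k)
  index₃ = ℕ-Solver.solve-∀

catalanPS≗catalanPowPS-1 : catalanPS ≗ catalanPowPS 1
catalanPS≗catalanPowPS-1 n = begin
  catalanPS n                      ≡⟨ catalanPS≡ballot n ⟩
  ballot (n ℕ.+ n) n               ≡⟨ cong₂ ballot (ℕₚ.+-identityʳ (n ℕ.+ n)) (ℕₚ.+-identityʳ n) ⟨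
  ballot (n ℕ.+ n ℕ.+ 0) (n ℕ.+ 0) ≡⟨ catalanPowPS-ballot 0 n ⟨
  catalanPowPS 1 n                 ∎

-- The triangle of (1 + ax)/(1 − x²)

evenPS : PS
evenPS zero          = 1ℤ
evenPS (suc zero)    = 0ℤ
evenPS (suc (suc n)) = evenPS n

mulPS-oneMinusXSq-suc-suc : ∀ f m → mulPS oneMinusXSq f (suc (suc m)) ≡ f (suc (suc m)) - f m
mulPS-oneMinusXSq-suc-suc f m = begin
  mulPS oneMinusXSq f (2 ℕ.+ m)
    ≡⟨ trans (sumTo-sucˡ (suc m) _) (cong (λ s → 1ℤ * f (2 ℕ.+ m) + s) (sumTo-sucˡ m _)) ⟩
  1ℤ * f (2 ℕ.+ m) + (0ℤ * f (suc m) + sumTo m (λ i → oneMinusXSq (2 ℕ.+ i) * f (m ∸ i)))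
    ≡⟨ cong (λ s → 1ℤ * f (2 ℕ.+ m) + (0ℤ * f (suc m) + s)) (tail m) ⟩
  1ℤ * f (2 ℕ.+ m) + (0ℤ * f (suc m) + - 1ℤ * f m)
    ≡⟨ simplify (f (2 ℕ.+ m)) (f (suc m)) (f m) ⟩
  f (2 ℕ.+ m) - f m ∎
  where
  tail : ∀ m → sumTo m (λ i → oneMinusXSq (2 ℕ.+ i) * f (m ∸ i)) ≡ - 1ℤ * f m
  tail zero    = refl
  tail (suc m) = trans (sumTo-sucˡ m _)
                       (trans (cong (λ s → - 1ℤ * f (suc m) + s) (sumTo-zeroˡ m (λ i → f (m ∸ i))))
                              (ℤₚ.+-identityʳ _))
  simplify : ∀ x y z → 1ℤ * x + (0ℤ * y + - 1ℤ * z) ≡ x - z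
  simplify = solve-∀

invPS-oneMinusXSq : invPS oneMinusXSq ≗ evenPS
invPS-oneMinusXSq = invPS-unique oneMinusXSq evenPS refl [1-x²]*even≗1
  where
  [1-x²]*even≗1 : mulPS oneMinusXSq evenPS ≗ onePS
  [1-x²]*even≗1 zero          = refl
  [1-x²]*even≗1 (suc zero)    = refl
  [1-x²]*even≗1 (suc (suc m)) =
    trans (mulPS-oneMinusXSq-suc-suc evenPS m) (ℤₚ.+-inverseʳ (evenPS m))

gCoeff : ℤ → PS
gCoeff a zero    = 1ℤ
gCoeff a (suc k) = evenPS (suc k) + a * evenPS k

gSeq≗gCoeff : ∀ a → gSeq a ≗ gCoeff a
gSeq≗gCoeff a n = trans (mulPS-cong numer≗linearPS invPS-oneMinusXSq n) ([1+ax]*even≗gCoeff n)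
  where
  numer≗linearPS : numer a ≗ linearPS 1ℤ a
  numer≗linearPS zero          = refl
  numer≗linearPS (suc zero)    = refl
  numer≗linearPS (suc (suc n)) = refl
  [1+ax]*even≗gCoeff : mulPS (linearPS 1ℤ a) evenPS ≗ gCoeff a
  [1+ax]*even≗gCoeff zero    = refl
  [1+ax]*even≗gCoeff (suc m) =
    trans (mulPS-linearPS-suc 1ℤ a evenPS m) (cong (_+ a * evenPS m) (ℤₚ.*-identityˡ (evenPS (suc m))))

xOver1mxPow : ℕ → PS
xOver1mxPow zero          = onePS
xOver1mxPow (suc k) zero    = 0ℤ
xOver1mxPow (suc k) (suc n) = + (n C k)

sumTo-onePS : ∀ m → sumTo m onePS ≡ 1ℤ
sumTo-onePS zero    = refl
sumTo-onePS (suc m) = trans (ℤₚ.+-identityʳ _) (sumTo-onePS m)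

sumTo-xOver1mxPow : ∀ k m → sumTo m (xOver1mxPow k) ≡ + (m C k)
sumTo-xOver1mxPow zero    m       = sumTo-onePS m
sumTo-xOver1mxPow (suc k) zero    = refl
sumTo-xOver1mxPow (suc k) (suc m) =
  trans (sumTo-sucˡ m (xOver1mxPow (suc k))) (trans (ℤₚ.+-identityˡ _) (sumTo-tCk≡[1+m]C[1+k] m k))

powPS-xOver1mx : ∀ k → powPS xOver1mx k ≗ xOver1mxPow k
powPS-xOver1mx zero    n       = refl
powPS-xOver1mx (suc k) zero    = ℤₚ.*-zeroˡ (powPS xOver1mx k 0)
powPS-xOver1mx (suc k) (suc m) = begin
  mulPS xOver1mx (powPS xOver1mx k) (suc m)  ≡⟨ mulPS-xOver1mx-suc (powPS xOver1mx k) m ⟩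
  sumTo m (powPS xOver1mx k)                 ≡⟨ sumTo-cong m (λ i _ → powPS-xOver1mx k i) ⟩
  sumTo m (xOver1mxPow k)                    ≡⟨ sumTo-xOver1mxPow k m ⟩
  + (m C k)                                  ∎

binomialSum : (ℕ → ℤ) → ℕ → ℤ
binomialSum φ m = sumTo m (λ k → φ k * + (m C k))

binomialSum-suc : ∀ φ m → binomialSum φ (suc m) ≡ binomialSum (φ ∘ suc) m + binomialSum φ m
binomialSum-suc φ m = begin
  binomialSum φ (suc m)
    ≡⟨ sumTo-sucˡ m _ ⟩
  φ 0 * 1ℤ + sumTo m (λ k → φ (suc k) * + (suc m C suc k))
    ≡⟨ cong (λ s → φ 0 * 1ℤ + s) (trans (sumTo-cong m (λ k _ → pascal k)) (sumTo-distrib-+ m _ _)) ⟩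
  φ 0 * 1ℤ + (binomialSum (φ ∘ suc) m + R)
    ≡⟨ +-left-comm (φ 0 * 1ℤ) (binomialSum (φ ∘ suc) m) R ⟩
  binomialSum (φ ∘ suc) m + (φ 0 * 1ℤ + R)
    ≡⟨ cong (λ s → binomialSum (φ ∘ suc) m + s) dropLast ⟩
  binomialSum (φ ∘ suc) m + binomialSum φ m ∎
  where
  R = sumTo m (λ k → φ (suc k) * + (m C suc k))
  pascal : ∀ k → φ (suc k) * + (suc m C suc k) ≡ φ (suc k) * + (m C k) + φ (suc k) * + (m C suc k)
  pascal k = trans (cong (λ c → φ (suc k) * + c) (sym (nCk+nC[k+1]≡[n+1]C[k+1] m k)))
                   (trans (cong (φ (suc k) *_) (ℤₚ.pos-+ (m C k) _)) (ℤₚ.*-distribˡ-+ (φ (suc k)) _ _))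
  +-left-comm : ∀ x y z → x + (y + z) ≡ y + (x + z)
  +-left-comm = solve-∀
  dropLast : φ 0 * 1ℤ + R ≡ binomialSum φ m
  dropLast = begin
    φ 0 * 1ℤ + R                                        ≡⟨ sumTo-sucˡ m (λ k → φ k * + (m C k)) ⟨
    binomialSum φ m + φ (suc m) * + (m C suc m)         ≡⟨ cong (λ c → binomialSum φ m + φ (suc m) * + c)
                                                                 (k>n⇒nCk≡0 (ℕₚ.n<1+n m)) ⟩
    binomialSum φ m + φ (suc m) * 0ℤ                    ≡⟨ cong (λ s → binomialSum φ m + s) (ℤₚ.*-zeroʳ (φ (suc m))) ⟩
    binomialSum φ m + 0ℤ                                ≡⟨ ℤₚ.+-identityʳ _ ⟩
    binomialSum φ m                                     ∎

composeXOver1mx-suc : ∀ g m → composeXOver1mx g (suc m) ≡ binomialSum (g ∘ suc) m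
composeXOver1mx-suc g m = begin
  composeXOver1mx g (suc m)
    ≡⟨ sumTo-sucˡ m _ ⟩
  g 0 * 0ℤ + sumTo m (λ k → g (suc k) * powPS xOver1mx (suc k) (suc m))
    ≡⟨ cong₂ _+_ (ℤₚ.*-zeroʳ (g 0)) (sumTo-cong m (λ k _ → cong (g (suc k) *_) (powPS-xOver1mx (suc k) (suc m)))) ⟩
  0ℤ + binomialSum (g ∘ suc) m
    ≡⟨ ℤₚ.+-identityˡ _ ⟩
  binomialSum (g ∘ suc) m ∎

mulPS-geomPS-geomPS-powPS : ∀ k m →
  mulPS geomPS (mulPS geomPS (powPS xOver1mx k)) m ≡ + (suc m C suc k)
mulPS-geomPS-geomPS-powPS k m = begin
  mulPS geomPS (mulPS geomPS (powPS xOver1mx k)) m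
    ≡⟨ mulPS-geomPS _ m ⟩
  sumTo m (mulPS geomPS (powPS xOver1mx k))
    ≡⟨ sumTo-cong m (λ t _ → trans (mulPS-geomPS _ t)
                                   (trans (sumTo-cong t (λ i _ → powPS-xOver1mx k i)) (sumTo-xOver1mxPow k t))) ⟩
  sumTo m (λ t → + (t C k))
    ≡⟨ sumTo-tCk≡[1+m]C[1+k] m k ⟩
  + (suc m C suc k) ∎

[1-2x]*geomPS²*powPS≗ballot : ∀ k →
  mulPS [1-2x] (mulPS geomPS (mulPS geomPS (powPS xOver1mx k))) ≗ λ m → ballot m k
[1-2x]*geomPS²*powPS≗ballot k zero    =
  trans (cong (1ℤ *_) (mulPS-geomPS-geomPS-powPS k 0))
        (trans (sym (ℤₚ.+-identityʳ _)) (1*[1+m]C[1+k]-2*mC[1+k]≡ballot 0 k))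
[1-2x]*geomPS²*powPS≗ballot k (suc m) = begin
  mulPS [1-2x] F (suc m)
    ≡⟨ mulPS-linearPS-suc 1ℤ (- + 2) F m ⟩
  1ℤ * F (suc m) + - + 2 * F m
    ≡⟨ cong₂ (λ u v → 1ℤ * u + - + 2 * v) (mulPS-geomPS-geomPS-powPS k (suc m))
                                          (mulPS-geomPS-geomPS-powPS k m) ⟩
  1ℤ * + (suc (suc m) C suc k) + - + 2 * + (suc m C suc k)
    ≡⟨ 1*[1+m]C[1+k]-2*mC[1+k]≡ballot (suc m) k ⟩
  ballot (suc m) k ∎
  where
  F = mulPS geomPS (mulPS geomPS (powPS xOver1mx k))

open import Algebra.Solver.CommutativeMonoid mulPS-commutativeMonoid using (solve; _⊜_; _⊕_)

module GSeqTriangle (a : ℤ) where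

  b : ℤ
  b = a - 1ℤ

  [1+bx] : PS
  [1+bx] = linearPS 1ℤ b

  composed : PS
  composed = composeXOver1mx (gSeq a)

  composed-suc : ∀ m → composed (suc m) ≡ binomialSum (gCoeff a ∘ suc) m
  composed-suc m = trans (composeXOver1mx-suc (gSeq a) m)
                         (sumTo-cong m (λ k _ → cong (_* + (m C k)) (gSeq≗gCoeff a (suc k))))

  [1-2x]*composed≗[1-x]*[1+bx] : mulPS [1-2x] composed ≗ mulPS [1-x] [1+bx]
  [1-2x]*composed≗[1-x]*[1+bx] zero          = refl
  [1-2x]*composed≗[1-x]*[1+bx] (suc zero)    =
    trans (cong (λ u → 1ℤ * u + - + 2 * 1ℤ) (composed-suc 0)) (value a)
    where
    value : ∀ a → 1ℤ * ((0ℤ + a * 1ℤ) * 1ℤ) + - + 2 * 1ℤ ≡ 1ℤ * (a - 1ℤ) + - 1ℤ * 1ℤ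
    value = solve-∀
  [1-2x]*composed≗[1-x]*[1+bx] (suc (suc m)) = begin
    mulPS [1-2x] composed (2 ℕ.+ m)
      ≡⟨ mulPS-linearPS-suc 1ℤ (- + 2) composed (suc m) ⟩
    1ℤ * composed (2 ℕ.+ m) + - + 2 * composed (suc m)
      ≡⟨ cong₂ (λ u v → 1ℤ * u + - + 2 * v) (composed-suc (suc m)) (composed-suc m) ⟩
    1ℤ * B₁ (suc m) + - + 2 * B₁ m
      ≡⟨ cong (λ u → 1ℤ * u + - + 2 * B₁ m) (binomialSum-suc (gCoeff a ∘ suc) m) ⟩
    1ℤ * (B₂ m + B₁ m) + - + 2 * B₁ m
      ≡⟨ simplify (B₂ m) (B₁ m) ⟩
    B₂ m - B₁ m
      ≡⟨ B₂-B₁ m ⟩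
    - [1+bx] (suc m)
      ≡⟨ negate ([1+bx] (suc m)) ⟨
    1ℤ * 0ℤ + - 1ℤ * [1+bx] (suc m)
      ≡⟨ mulPS-linearPS-suc 1ℤ (- 1ℤ) [1+bx] (suc m) ⟨
    mulPS [1-x] [1+bx] (2 ℕ.+ m) ∎
    where
    B₁ = binomialSum (gCoeff a ∘ suc)
    B₂ = binomialSum (gCoeff a ∘ suc ∘ suc)
    simplify : ∀ x y → 1ℤ * (x + y) + - + 2 * y ≡ x - y
    simplify = solve-∀
    negate : ∀ y → 1ℤ * 0ℤ + - 1ℤ * y ≡ - y
    negate = solve-∀
    -- B₁ and B₂ trade places under binomialSum-suc, as gCoeff a has period 2 from index 1 on.
    B₂-B₁ : ∀ m → B₂ m - B₁ m ≡ - [1+bx] (suc m)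
    B₂-B₁ zero    = value a
      where
      value : ∀ a → (1ℤ + a * 0ℤ) * 1ℤ - (0ℤ + a * 1ℤ) * 1ℤ ≡ - (a - 1ℤ)
      value = solve-∀
    B₂-B₁ (suc m) = begin
      B₂ (suc m) - B₁ (suc m)
        ≡⟨ cong₂ _-_ (binomialSum-suc (gCoeff a ∘ suc ∘ suc) m) (binomialSum-suc (gCoeff a ∘ suc) m) ⟩
      (B₁ m + B₂ m) - (B₂ m + B₁ m)
        ≡⟨ cancel (B₁ m) (B₂ m) ⟩
      0ℤ ∎
      where
      cancel : ∀ x y → (x + y) - (y + x) ≡ 0ℤ
      cancel = solve-∀

  invPS-composed : invPS composed ≗ mulPS [1-2x] (mulPS geomPS (geometricPS (- b)))
  invPS-composed = invPS-unique composed _ refl composed*inverse≗1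
    where
    K = geometricPS (- b)
    composed*inverse≗1 : mulPS composed (mulPS [1-2x] (mulPS geomPS K)) ≗ onePS
    composed*inverse≗1 n = begin
      mulPS composed (mulPS [1-2x] (mulPS geomPS K)) n
        ≡⟨ solve 4 (λ u l g k → u ⊕ (l ⊕ (g ⊕ k)) ⊜ (l ⊕ u) ⊕ (g ⊕ k)) (λ _ → refl)
                   composed [1-2x] geomPS K n ⟩
      mulPS (mulPS [1-2x] composed) (mulPS geomPS K) n
        ≡⟨ mulPS-congʳ (mulPS geomPS K) [1-2x]*composed≗[1-x]*[1+bx] n ⟩
      mulPS (mulPS [1-x] [1+bx]) (mulPS geomPS K) n
        ≡⟨ solve 4 (λ l₁ l₂ g k → (l₁ ⊕ l₂) ⊕ (g ⊕ k) ⊜ (l₁ ⊕ g) ⊕ (l₂ ⊕ k)) (λ _ → refl)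
                   [1-x] [1+bx] geomPS K n ⟩
      mulPS (mulPS [1-x] geomPS) (mulPS [1+bx] K) n
        ≡⟨ mulPS-cong [1-x]*geomPS≗1 (mulPS-linearPS-geometricPS b) n ⟩
      mulPS onePS onePS n
        ≡⟨ mulPS-identityˡ onePS n ⟩
      onePS n ∎

  tTri-gSeq : ∀ n k → tTri (gSeq a) n k ≡ sumTo n (λ i → (- b) ^ i * ballot (n ∸ i) k)
  tTri-gSeq n k = begin
    mulPS geomPS (mulPS (invPS composed) Y) n
      ≡⟨ mulPS-congˡ geomPS (mulPS-congʳ Y invPS-composed) n ⟩
    mulPS geomPS (mulPS (mulPS [1-2x] (mulPS geomPS K)) Y) n
      ≡⟨ solve 4 (λ l g k y → g ⊕ ((l ⊕ (g ⊕ k)) ⊕ y) ⊜ k ⊕ (l ⊕ (g ⊕ (g ⊕ y)))) (λ _ → refl)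
                 [1-2x] geomPS K Y n ⟩
    mulPS K (mulPS [1-2x] (mulPS geomPS (mulPS geomPS Y))) n
      ≡⟨ sumTo-cong n (λ i _ → cong (K i *_) ([1-2x]*geomPS²*powPS≗ballot k (n ∸ i))) ⟩
    sumTo n (λ i → (- b) ^ i * ballot (n ∸ i) k) ∎
    where
    K = geometricPS (- b)
    Y = powPS xOver1mx k

-- The INVERT transform of the Catalan series

module InvertCatalan (b : ℤ) where

  -- invertSeries e = Σᵢ (−b)ⁱ xⁱ c^(e+i): the cases e = 0, 1 are 1/(1 + bxc) and c/(1 + bxc).
  invertSeries : ℕ → PS
  invertSeries e n = sumTo n (λ i → (- b) ^ i * catalanPowPS (e ℕ.+ i) (n ∸ i))

  mulPS-catalanPS-invertSeries : mulPS catalanPS (invertSeries 0) ≗ invertSeries 1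
  mulPS-catalanPS-invertSeries n = begin
    sumTo n (λ k → catalanPS k * sumTo (n ∸ k) (λ i → (- b) ^ i * catalanPowPS i ((n ∸ k) ∸ i)))
      ≡⟨ sumTo-cong n (λ k _ → sym (sumTo-*ˡ (n ∸ k) (catalanPS k) _)) ⟩
    sumTo n (λ k → sumTo (n ∸ k) (λ i → catalanPS k * ((- b) ^ i * catalanPowPS i ((n ∸ k) ∸ i))))
      ≡⟨ sumTo-swap n (λ k i → catalanPS k * ((- b) ^ i * catalanPowPS i ((n ∸ k) ∸ i))) ⟩
    sumTo n (λ i → sumTo (n ∸ i) (λ k → catalanPS k * ((- b) ^ i * catalanPowPS i ((n ∸ k) ∸ i))))
      ≡⟨ sumTo-cong n (λ i _ → sumTo-cong (n ∸ i) (λ k _ →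
           trans (cong₂ (λ c j → c * ((- b) ^ i * catalanPowPS i j))
                        (catalanPS≗catalanPowPS-1 k) (∸-comm n k i))
                 (*-left-comm (catalanPowPS 1 k) ((- b) ^ i) _))) ⟩
    sumTo n (λ i → sumTo (n ∸ i) (λ k → (- b) ^ i * (catalanPowPS 1 k * catalanPowPS i ((n ∸ i) ∸ k))))
      ≡⟨ sumTo-cong n (λ i _ → trans (sumTo-*ˡ (n ∸ i) ((- b) ^ i) _)
                                     (cong ((- b) ^ i *_) (mulPS-catalanPowPS 1 i (n ∸ i)))) ⟩
    invertSeries 1 n ∎
    where
    ∸-comm : ∀ n k i → (n ∸ k) ∸ i ≡ (n ∸ i) ∸ k
    ∸-comm n k i = trans (ℕₚ.∸-+-assoc n k i) (trans (cong (n ∸_) (ℕₚ.+-comm k i)) (sym (ℕₚ.∸-+-assoc n i k)))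
    *-left-comm : ∀ x y z → x * (y * z) ≡ y * (x * z)
    *-left-comm = solve-∀

  invertSeries-suc : ∀ m → invertSeries 0 (suc m) ≡ (- b) * invertSeries 1 m
  invertSeries-suc m = begin
    invertSeries 0 (suc m)
      ≡⟨ sumTo-sucˡ m _ ⟩
    1ℤ * 0ℤ + sumTo m (λ i → ((- b) * (- b) ^ i) * catalanPowPS (suc i) (m ∸ i))
      ≡⟨ cong (λ s → 1ℤ * 0ℤ + s) (trans (sumTo-cong m (λ i _ → ℤₚ.*-assoc (- b) ((- b) ^ i) _))
                                  (sumTo-*ˡ m (- b) _)) ⟩
    0ℤ + (- b) * invertSeries 1 m
      ≡⟨ ℤₚ.+-identityˡ _ ⟩
    (- b) * invertSeries 1 m ∎

  -- The denominator 1 + bxc is local to invertTransform, so it is given by its coefficients.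
  invPS-invertDenominator : ∀ d → d 0 ≡ 1ℤ → (∀ n → d (suc n) ≡ b * catalanPS n) →
                            invPS d ≗ invertSeries 0
  invPS-invertDenominator d d₀≡1 d-suc = invPS-unique d (invertSeries 0) d₀≡1 d*V≗1
    where
    V = invertSeries 0
    W = invertSeries 1
    cancel : ∀ b w → 1ℤ * ((- b) * w) + b * w ≡ 0ℤ
    cancel = solve-∀
    d*V≗1 : mulPS d V ≗ onePS
    d*V≗1 zero    = cong (_* 1ℤ) d₀≡1
    d*V≗1 (suc m) = begin
      mulPS d V (suc m)
        ≡⟨ sumTo-sucˡ m _ ⟩
      d 0 * V (suc m) + sumTo m (λ k → d (suc k) * V (m ∸ k))
        ≡⟨ cong₂ _+_ (cong₂ _*_ d₀≡1 (invertSeries-suc m))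
                     (sumTo-cong m (λ k _ → trans (cong (_* V (m ∸ k)) (d-suc k))
                                                  (ℤₚ.*-assoc b (catalanPS k) _))) ⟩
      1ℤ * ((- b) * W m) + sumTo m (λ k → b * (catalanPS k * V (m ∸ k)))
        ≡⟨ cong (λ s → 1ℤ * ((- b) * W m) + s) (trans (sumTo-*ˡ m b _) (cong (b *_) (mulPS-catalanPS-invertSeries m))) ⟩
      1ℤ * ((- b) * W m) + b * W m
        ≡⟨ cancel b (W m) ⟩
      0ℤ ∎

  invertTransform-catalanPS : invertTransform b catalanPS ≗ invertSeries 1
  invertTransform-catalanPS n =
    trans (mulPS-congˡ catalanPS (invPS-invertDenominator _ refl (λ _ → refl)) n)
          (mulPS-catalanPS-invertSeries n)

sumTo-ballot-central : ∀ (f : ℕ → ℤ) n →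
  sumTo (n ℕ.+ n) (λ i → f i * ballot (n ℕ.+ n ∸ i) n) ≡ sumTo n (λ i → f i * catalanPowPS (suc i) (n ∸ i))
sumTo-ballot-central f n = begin
  sumTo (n ℕ.+ n) (λ i → f i * ballot (n ℕ.+ n ∸ i) n)
    ≡⟨ sumTo-extendʳ n n _ (λ i n<i i≤2n → trans (cong (f i *_) (ballot-< (2n∸i<n n<i i≤2n))) (ℤₚ.*-zeroʳ (f i))) ⟩
  sumTo n (λ i → f i * ballot (n ℕ.+ n ∸ i) n)
    ≡⟨ sumTo-cong n (λ i i≤n → cong (f i *_) (begin
         ballot (n ℕ.+ n ∸ i) n
           ≡⟨ cong₂ ballot (2n∸i≡2[n∸i]+i i≤n) (sym (ℕₚ.m∸n+n≡m i≤n)) ⟩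
         ballot ((n ∸ i) ℕ.+ (n ∸ i) ℕ.+ i) ((n ∸ i) ℕ.+ i)
           ≡⟨ catalanPowPS-ballot i (n ∸ i) ⟨
         catalanPowPS (suc i) (n ∸ i) ∎)) ⟩
  sumTo n (λ i → f i * catalanPowPS (suc i) (n ∸ i)) ∎
  where
  2n∸i<n : ∀ {i} → n < i → i ≤ n ℕ.+ n → n ℕ.+ n ∸ i < n
  2n∸i<n {i} n<i i≤2n = subst (n ℕ.+ n ∸ i <_) (ℕₚ.m+n∸n≡m n n) (ℕₚ.∸-monoʳ-< n<i i≤2n)
  2n∸i≡2[n∸i]+i : ∀ {i} → i ≤ n → n ℕ.+ n ∸ i ≡ (n ∸ i) ℕ.+ (n ∸ i) ℕ.+ i
  2n∸i≡2[n∸i]+i {i} i≤n = begin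
    n ℕ.+ n ∸ i                                 ≡⟨ cong (λ m → m ℕ.+ m ∸ i) (ℕₚ.m∸n+n≡m i≤n) ⟨
    (j ℕ.+ i) ℕ.+ (j ℕ.+ i) ∸ i                 ≡⟨ cong (_∸ i) (regroup j i) ⟩
    (j ℕ.+ j ℕ.+ i) ℕ.+ i ∸ i                   ≡⟨ ℕₚ.m+n∸n≡m (j ℕ.+ j ℕ.+ i) i ⟩
    j ℕ.+ j ℕ.+ i                               ∎
    where
    j = n ∸ i
    regroup : ∀ j i → (j ℕ.+ i) ℕ.+ (j ℕ.+ i) ≡ (j ℕ.+ j ℕ.+ i) ℕ.+ i
    regroup = ℕ-Solver.solve-∀

mainTheorem6 : (a : ℤ) → ∀ n →
    centralTransform (gSeq a) n ≡ invertTransform (a - 1ℤ) catalanPS n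
mainTheorem6 a n = begin
  centralTransform (gSeq a) n
    ≡⟨ tTri-gSeq (2 ℕ.* n) n ⟩
  sumTo (2 ℕ.* n) (λ i → (- b) ^ i * ballot (2 ℕ.* n ∸ i) n)
    ≡⟨ cong (λ m → sumTo m (λ i → (- b) ^ i * ballot (m ∸ i) n)) (cong (n ℕ.+_) (ℕₚ.+-identityʳ n)) ⟩
  sumTo (n ℕ.+ n) (λ i → (- b) ^ i * ballot (n ℕ.+ n ∸ i) n)
    ≡⟨ sumTo-ballot-central ((- b) ^_) n ⟩
  invertSeries 1 n
    ≡⟨ invertTransform-catalanPS n ⟨
  invertTransform b catalanPS n ∎
  where
  open GSeqTriangle a
  open InvertCatalan b
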